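{- Let $r\ge1$ be an integer, let $G$ be a graph of maximum degree $2$, let $y_1,y_2,\dots,y_{2r+2}$ be a path in $G$, and let $D$ be an $r$-identifying code of $G$. Then it is impossible that both $y_1\notin D$ and $y_{2r+2}\notin D$.
   Context: For a graph $G=(V,E)$ and integer $r\ge1$, $d(x,y)$ is the number of edges in a shortest path between $x$ and $y$, $N_r[x]=\{y\in V: d(x,y)\le r\}$, and for $D\subseteq V$, $D_r(x)=N_r[x]\cap D$. A set $D\subseteq V$ is an $r$-identifying code of $G$ if $D_r(x)\neq\emptyset$ for every $x\in V$ and $D_r(x)\neq D_r(y)$ for all distinct $x,y\in V$. -}

module Defs where

open import Data.Nat using (ℕ; zero; suc; _+_; _*_; _≤_)
open import Data.Fin using (Fin; zero; suc; inject₁; fromℕ)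
open import Data.Bool using (Bool; true; false; if_then_else_)
open import Data.List using (List; map; allFin)
open import Data.Nat.ListAction using (sum)
open import Data.Product using (Σ; ∃; _×_; _,_)
open import Relation.Binary.PropositionalEquality using (_≡_)
open import Relation.Nullary using (¬_)
open import Function.Bundles using (_⇔_)
open import Function.Definitions using (Injective)

record Graph (n : ℕ) : Set where
  field
    Adj     : Fin n → Fin n → Bool
    sym     : ∀ x y → Adj x y ≡ Adj y x
    irrefl  : ∀ x → Adj x x ≡ false

open Graph public

degree : ∀ {n} → Graph n → Fin n → ℕ
degree {n} G v = sum (map (λ w → if Adj G v w then 1 else 0) (allFin n))

MaxDegree≤2 : ∀ {n} → Graph n → Set
MaxDegree≤2 G = ∀ v → degree G v ≤ 2

data Walk {n : ℕ} (G : Graph n) : Fin n → Fin n → ℕ → Set where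
  nil  : ∀ {x} → Walk G x x 0
  cons : ∀ {x y z k} → Adj G x y ≡ true → Walk G y z k → Walk G x z (suc k)

DistLe : ∀ {n} → Graph n → Fin n → Fin n → ℕ → Set
DistLe G x y r = ∃ λ k → k ≤ r × Walk G x y k

-- codes are sets of vertices, given as predicates
-- z ∈ D_r(x) = N_r[x] ∩ D
InDr : ∀ {n} → Graph n → (Fin n → Set) → ℕ → Fin n → Fin n → Set
InDr G D r x z = DistLe G x z r × D z

IsIdentifyingCode : ∀ {n} → Graph n → ℕ → (Fin n → Set) → Set
IsIdentifyingCode {n} G r D =
  (∀ x → ∃ λ z → InDr G D r x z) ×
  (∀ x y → ¬ (x ≡ y) → ¬ (∀ z → InDr G D r x z ⇔ InDr G D r y z))

IsPath : ∀ {n m} → Graph n → (Fin (suc m) → Fin n) → Set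
IsPath {m = m} G y =
  Injective _≡_ _≡_ y × (∀ (i : Fin m) → Adj G (y (inject₁ i)) (y (suc i)) ≡ true)

-- Two consecutive middle vertices of a long path cannot be separated.
--
-- Let y_0, …, y_m (m = 2r+1) be the path and write c = r, c' = r+1 for its
-- two middle indices.  Because G has maximum degree 2, an interior vertex of
-- the path has no neighbours besides its two path neighbours, so a walk of
-- length ≤ r from y_c or y_c' never leaves the path: it cannot reach an end
-- y_0, y_m and step off it.  Hence every codeword within distance r of y_c
-- or y_c' is some y_j; if y_0, y_m ∉ D then 1 ≤ j ≤ 2r, and every such y_j is
-- within distance r of both y_c and y_c'.  So D_r(y_c) = D_r(y_c'),
-- contradicting the separation property of the identifying code.
module Submission where

open import Defs hiding (sym)
open import Data.Nat using (ℕ; zero; suc; _+_; _*_; _≤_; _<_; z≤n; s≤s)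
open import Data.Nat.Properties
open import Data.Fin using (Fin; zero; suc; fromℕ; toℕ; inject₁; fromℕ<)
open import Data.Fin.Properties using (toℕ-injective; toℕ-fromℕ<; toℕ-inject₁)
import Data.Fin as Fin
open import Data.List using (List; []; _∷_; map; length)
open import Data.List.Relation.Unary.All as All using (All; []; _∷_)
open import Data.List.Relation.Unary.Any using (here; there; _─_)
open import Data.List.Relation.Unary.AllPairs using ([]; _∷_)
open import Data.List.Relation.Unary.Unique.Propositional using (Unique)
open import Data.List.Membership.Propositional using (_∈_)
open import Data.List.Membership.Propositional.Properties using (∈-allFin)
open import Data.Nat.ListAction using (sum)
open import Data.Bool using (true; if_then_else_)
open import Data.Product using (_×_; _,_; ∃; proj₁; proj₂)
open import Data.Sum using (_⊎_; inj₁; inj₂)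
open import Data.Empty using (⊥-elim)
open import Relation.Nullary using (¬_; yes; no)
open import Relation.Binary.PropositionalEquality
open import Function.Base using (_∘_)
open import Algebra.Properties.CommutativeSemigroup +-commutativeSemigroup using (x∙yz≈y∙xz)
open import Function.Bundles using (mk⇔)

-- Counting with a weight h on the elements of a list; instantiated with the
-- adjacency indicator of a vertex, the total weight of allFin is its degree.
module Counting {A : Set} (h : A → ℕ) where

  sum-─ : ∀ {a : A} {xs} (a∈xs : a ∈ xs) → sum (map h xs) ≡ h a + sum (map h (xs ─ a∈xs))
  sum-─ (here refl) = refl
  sum-─ {a} {x ∷ xs} (there a∈xs) = begin
    h x + sum (map h xs)                    ≡⟨ cong (h x +_) (sum-─ a∈xs) ⟩
    h x + (h a + sum (map h (xs ─ a∈xs)))   ≡⟨ x∙yz≈y∙xz (h x) (h a) _ ⟩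
    h a + (h x + sum (map h (xs ─ a∈xs)))   ∎
    where open ≡-Reasoning

  ∈-─ : ∀ {a b : A} {xs} (a∈xs : a ∈ xs) → a ≢ b → b ∈ xs → b ∈ (xs ─ a∈xs)
  ∈-─ (here refl) a≢b (here refl) = ⊥-elim (a≢b refl)
  ∈-─ (here refl) a≢b (there b∈xs) = b∈xs
  ∈-─ (there a∈xs) a≢b (here refl) = here refl
  ∈-─ (there a∈xs) a≢b (there b∈xs) = there (∈-─ a∈xs a≢b b∈xs)

  length≤sum : ∀ {as xs : List A} → Unique as → All (_∈ xs) as → All (λ a → 1 ≤ h a) as →
               length as ≤ sum (map h xs)
  length≤sum [] [] [] = z≤n
  length≤sum {a ∷ as} {xs} (a≢as ∷ unique) (a∈xs ∷ as⊆xs) (ha ∷ has) = begin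
    1 + length as                    ≤⟨ +-mono-≤ ha (length≤sum unique as⊆xs′ has) ⟩
    h a + sum (map h (xs ─ a∈xs))    ≡⟨ sym (sum-─ a∈xs) ⟩
    sum (map h xs)                   ∎
    where
    open ≤-Reasoning
    as⊆xs′ : All (_∈ (xs ─ a∈xs)) as
    as⊆xs′ = All.zipWith (λ { (a≢b , b∈xs) → ∈-─ a∈xs a≢b b∈xs }) (a≢as , as⊆xs)

module _ {n : ℕ} (G : Graph n) where

  third-neighbour : ∀ {v a b c} → degree G v ≤ 2 →
    Adj G v a ≡ true → Adj G v b ≡ true → Adj G v c ≡ true →
    c ≡ a ⊎ c ≡ b ⊎ a ≡ b
  third-neighbour {v} {a} {b} {c} deg va vb vc
    with c Fin.≟ a | c Fin.≟ b | a Fin.≟ b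
  ... | yes c≡a | _       | _       = inj₁ c≡a
  ... | no _    | yes c≡b | _       = inj₂ (inj₁ c≡b)
  ... | no _    | no _    | yes a≡b = inj₂ (inj₂ a≡b)
  ... | no c≢a  | no c≢b  | no a≢b  = ⊥-elim (<⇒≱ three≤degree deg)
    where
    open Counting (λ w → if Adj G v w then 1 else 0)
    positive : ∀ {w} → Adj G v w ≡ true → 1 ≤ (if Adj G v w then 1 else 0)
    positive vw rewrite vw = ≤-refl
    three≤degree : 3 ≤ degree G v
    three≤degree = length≤sum
      ((a≢b ∷ (c≢a ∘ sym) ∷ []) ∷ ((c≢b ∘ sym) ∷ []) ∷ [] ∷ [])
      (∈-allFin a ∷ ∈-allFin b ∷ ∈-allFin c ∷ [])
      (positive va ∷ positive vb ∷ positive vc ∷ [])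

  snoc : ∀ {x y z k} → Walk G x y k → Adj G y z ≡ true → Walk G x z (suc k)
  snoc nil yz = cons yz nil
  snoc (cons xw w) yz = cons xw (snoc w yz)

  reverse : ∀ {x z k} → Walk G x z k → Walk G z x k
  reverse nil = nil
  reverse (cons {x} {y} xy w) = snoc (reverse w) (trans (Graph.sym G y x) xy)

  dist-sym : ∀ {x z r} → DistLe G x z r → DistLe G z x r
  dist-sym (k , k≤r , w) = k , k≤r , reverse w

-- To do arithmetic on positions along a path we index it by ℕ; clamp m j is
-- the index j read in Fin (suc m), saturating at m; it is only used for j ≤ m.
clamp : (m : ℕ) → ℕ → Fin (suc m)
clamp m zero = zero
clamp zero (suc j) = zero
clamp (suc m) (suc j) = suc (clamp m j)

toℕ-clamp : ∀ m j → j ≤ m → toℕ (clamp m j) ≡ j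
toℕ-clamp m zero _ = refl
toℕ-clamp (suc m) (suc j) (s≤s j≤m) = cong suc (toℕ-clamp m j j≤m)

clamp-fromℕ : ∀ m → clamp m m ≡ fromℕ m
clamp-fromℕ zero = refl
clamp-fromℕ (suc m) = cong suc (clamp-fromℕ m)

module OnPath {n m : ℕ} (G : Graph n) (deg : MaxDegree≤2 G)
              (y : Fin (suc m) → Fin n) (path : IsPath G y) where

  Y : ℕ → Fin n
  Y j = y (clamp m j)

  Y-injective : ∀ {i j} → i ≤ m → j ≤ m → Y i ≡ Y j → i ≡ j
  Y-injective {i} {j} i≤m j≤m Yi≡Yj = begin
    i                    ≡⟨ sym (toℕ-clamp m i i≤m) ⟩
    toℕ (clamp m i)      ≡⟨ cong toℕ (proj₁ path Yi≡Yj) ⟩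
    toℕ (clamp m j)      ≡⟨ toℕ-clamp m j j≤m ⟩
    j                    ∎
    where open ≡-Reasoning

  Y-adjacent : ∀ i → i < m → Adj G (Y i) (Y (suc i)) ≡ true
  Y-adjacent i i<m =
    subst₂ (λ a b → Adj G (y a) (y b) ≡ true) (sym clamp-i) (sym clamp-1+i) (proj₂ path f)
    where
    f : Fin m
    f = fromℕ< i<m
    clamp-i : clamp m i ≡ inject₁ f
    clamp-i = toℕ-injective
      (trans (toℕ-clamp m i (<⇒≤ i<m)) (sym (trans (toℕ-inject₁ f) (toℕ-fromℕ< i<m))))
    clamp-1+i : clamp m (suc i) ≡ suc f
    clamp-1+i = toℕ-injective
      (trans (toℕ-clamp m (suc i) i<m) (sym (cong suc (toℕ-fromℕ< i<m))))

  interior-neighbour : ∀ p {w} → suc p < m → Adj G (Y (suc p)) w ≡ true →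
                       w ≡ Y p ⊎ w ≡ Y (suc (suc p))
  interior-neighbour p p+1<m vw
    with third-neighbour G (deg (Y (suc p))) backward forward vw
    where
    backward : Adj G (Y (suc p)) (Y p) ≡ true
    backward = trans (Graph.sym G _ _) (Y-adjacent p (<⇒≤ p+1<m))
    forward : Adj G (Y (suc p)) (Y (suc (suc p))) ≡ true
    forward = Y-adjacent (suc p) p+1<m
  ... | inj₁ w≡Yp = inj₁ w≡Yp
  ... | inj₂ (inj₁ w≡Yp+2) = inj₂ w≡Yp+2
  ... | inj₂ (inj₂ Yp≡Yp+2) with Y-injective (≤-trans (n≤1+n p) (<⇒≤ p+1<m)) p+1<m Yp≡Yp+2
  ...   | ()

  -- A walk of length k from y_i with k ≤ i and i + k ≤ m cannot reach an end
  -- of the path early enough to leave it, so it ends on the path.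
  walk-on-path : ∀ {z k} i → Walk G (Y i) z k → k ≤ i → i + k ≤ m →
                 ∃ λ j → j ≤ m × z ≡ Y j
  walk-on-path i nil _ i+0≤m = i , subst (_≤ m) (+-identityʳ i) i+0≤m , refl
  walk-on-path {z} {suc k} (suc p) (cons {y = w} vw rest) (s≤s k≤p) i+k≤m =
    step (interior-neighbour p p+1<m vw)
    where
    p+k+2≤m : suc (suc (p + k)) ≤ m
    p+k+2≤m = subst (_≤ m) (+-suc (suc p) k) i+k≤m
    p+1<m : suc p < m
    p+1<m = ≤-trans (s≤s (s≤s (m≤m+n p k))) p+k+2≤m
    continue-from : ∀ {u} → w ≡ u → Walk G u z k
    continue-from w≡u = subst (λ u → Walk G u z k) w≡u rest
    step : w ≡ Y p ⊎ w ≡ Y (suc (suc p)) → ∃ λ j → j ≤ m × z ≡ Y j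
    step (inj₁ backward) =
      walk-on-path p (continue-from backward) k≤p (≤-trans (m≤n+m (p + k) 2) p+k+2≤m)
    step (inj₂ forward) =
      walk-on-path (suc (suc p)) (continue-from forward) (≤-trans k≤p (m≤n+m p 2)) p+k+2≤m

  walk-forward : ∀ i d → i + d ≤ m → Walk G (Y i) (Y (i + d)) d
  walk-forward i zero _ rewrite +-identityʳ i = nil
  walk-forward i (suc d) i+d+1≤m rewrite +-suc i d =
    cons (Y-adjacent i (≤-trans (s≤s (m≤m+n i d)) i+d+1≤m)) (walk-forward (suc i) d i+d+1≤m)

  dist-forward : ∀ {r a b} → a ≤ b → b ≤ m → b ≤ a + r → DistLe G (Y a) (Y b) r
  dist-forward {r} {a} a≤b b≤m b≤a+r with m≤n⇒∃[o]m+o≡n a≤b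
  ... | d , refl = d , +-cancelˡ-≤ a d r b≤a+r , walk-forward a d b≤m

  path-dist : ∀ {r} c j → c ≤ m → j ≤ m → j ≤ c + r → c ≤ j + r → DistLe G (Y c) (Y j) r
  path-dist c j c≤m j≤m j≤c+r c≤j+r with ≤-total c j
  ... | inj₁ c≤j = dist-forward c≤j j≤m j≤c+r
  ... | inj₂ j≤c = dist-sym G (dist-forward j≤c c≤m c≤j+r)

  interior-codeword : ∀ (D : Fin n → Set) {j} → ¬ D (Y 0) → ¬ D (Y m) → j ≤ m → D (Y j) →
                      1 ≤ j × j < m
  interior-codeword D {zero} ¬D-first _ _ Dj = ⊥-elim (¬D-first Dj)
  interior-codeword D {suc _} _ ¬D-last j≤m Dj =
    s≤s z≤n , ≤∧≢⇒< j≤m (λ { refl → ¬D-last Dj })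

  -- A centre c whose r-ball stays inside the path (r ≤ c, c + r ≤ m) and
  -- reaches every interior vertex (c ≤ r + 1, m ≤ c + r + 1).
  Central : ℕ → ℕ → Set
  Central r c = r ≤ c × c + r ≤ m × c ≤ suc r × m ≤ suc (c + r)

  central-≤m : ∀ {r c} → Central r c → c ≤ m
  central-≤m {r} {c} (_ , c+r≤m , _) = ≤-trans (m≤m+n c r) c+r≤m

  middle-central : ∀ {r} → m ≡ suc (r + r) → Central r r × Central r (suc r)
  middle-central {r} refl =
    (≤-refl , n≤1+n (r + r) , n≤1+n r , ≤-refl) ,
    (n≤1+n r , ≤-refl , ≤-refl , n≤1+n (suc (r + r)))

  -- If both ends of the path avoid D, every codeword within distance r of a
  -- central vertex is an interior path vertex, hence within distance r of
  -- any other central vertex: all central vertices have the same D_r.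
  central-balls : ∀ {r c c′} (D : Fin n → Set) → ¬ D (Y 0) → ¬ D (Y m) →
    Central r c → Central r c′ → ∀ z → InDr G D r (Y c) z → InDr G D r (Y c′) z
  central-balls {r} {c} {c′} D ¬D-first ¬D-last
    (r≤c , c+r≤m , _) central′@(_ , _ , c′≤1+r , m≤1+c′+r) z ((k , k≤r , walk) , Dz)
    with walk-on-path c walk (≤-trans k≤r r≤c) (≤-trans (+-monoʳ-≤ c k≤r) c+r≤m)
  ... | j , j≤m , refl with interior-codeword D ¬D-first ¬D-last j≤m Dz
  ...   | 1≤j , j<m = path-dist c′ j (central-≤m central′) j≤m j≤c′+r c′≤j+r , Dz
    where
    j≤c′+r : j ≤ c′ + r
    j≤c′+r = ≤-pred (≤-trans j<m m≤1+c′+r)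
    c′≤j+r : c′ ≤ j + r
    c′≤j+r = ≤-trans c′≤1+r (+-monoˡ-≤ r 1≤j)

-- The theorem: the two middle vertices y_r, y_{r+1} would have equal r-balls
-- in D.  (The argument does not need the hypothesis 1 ≤ r.)
lemma1 : ∀ {n} (r : ℕ) → 1 ≤ r → (G : Graph n) → MaxDegree≤2 G →
    (y : Fin (suc (2 * r + 1)) → Fin n) → IsPath G y →
    (D : Fin n → Set) → IsIdentifyingCode G r D →
    ¬ (¬ D (y zero) × ¬ D (y (fromℕ (2 * r + 1))))
lemma1 r _ G deg y path D (_ , separates) (¬D-first , ¬D-last) =
  separates (Y r) (Y (suc r)) Yr≢Yr+1
    (λ z → mk⇔ (central-balls D ¬D-first ¬D-last′ central-r central-r+1 z)
               (central-balls D ¬D-first ¬D-last′ central-r+1 central-r z))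
  where
  open OnPath G deg y path
  2r+1≡1+r+r : 2 * r + 1 ≡ suc (r + r)
  2r+1≡1+r+r = trans (+-comm (2 * r) 1) (cong (λ t → suc (r + t)) (+-identityʳ r))
  central-r : Central r r
  central-r = proj₁ (middle-central 2r+1≡1+r+r)
  central-r+1 : Central r (suc r)
  central-r+1 = proj₂ (middle-central 2r+1≡1+r+r)
  ¬D-last′ : ¬ D (Y (2 * r + 1))
  ¬D-last′ = subst (λ t → ¬ D (y t)) (sym (clamp-fromℕ (2 * r + 1))) ¬D-last
  Yr≢Yr+1 : Y r ≢ Y (suc r)
  Yr≢Yr+1 Yr≡Yr+1 =
    <⇒≢ (n<1+n r) (Y-injective (central-≤m central-r) (central-≤m central-r+1) Yr≡Yr+1)
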